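{- Let $a<b$ be positive integers with $a$ even and $b$ odd. Then there is no infinite smooth word over $\{a,b\}$ that is also an infinite Lyndon word.
   Context: Words over $\{a,b\}$ are compared lexicographically with $a<b$. For a word $w$ over $\{a,b\}$ written as maximal blocks $\alpha_0^{i_0}\alpha_1^{i_1}\cdots$ ($\alpha_{k+1}\ne\alpha_k$, $i_k\ge1$), $\Delta(w)=i_0i_1\cdots$. An infinite word $w\in\{a,b\}^\omega$ is smooth if $\Delta^k(w)\in\{a,b\}^\omega$ for all $k\ge0$. An infinite Lyndon word is an infinite word strictly smaller than each of its proper suffixes. -}

module Defs where

open import Data.Nat using (ℕ; zero; suc; _+_; _<_; _≤_)
open import Data.Product using (Σ; _×_; ∃)
open import Data.Sum using (_⊎_)
open import Relation.Binary.PropositionalEquality using (_≡_; _≢_)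

Word : Set
Word = ℕ → ℕ

OverAB : ℕ → ℕ → Word → Set
OverAB a b w = ∀ i → (w i ≡ a) ⊎ (w i ≡ b)

startPos : Word → ℕ → ℕ
startPos v zero    = 0
startPos v (suc k) = startPos v k + v k

-- IsDelta w v : v = Δ(w), i.e. w decomposes into infinitely many maximal
-- blocks, the k-th block starting at position startPos v k and having
-- length v k ≥ 1 (consecutive blocks carry different letters).
IsDelta : Word → Word → Set
IsDelta w v =
  (∀ k → 1 ≤ v k) ×
  (∀ k i → i < v k → w (startPos v k + i) ≡ w (startPos v k)) ×
  (∀ k → w (startPos v (suc k)) ≢ w (startPos v k))

-- w is smooth over {a,b}: the iterates Δ^k(w) all exist as infinite
-- words and lie in {a,b}^ω.  (Δ is deterministic, so the sequence W of
-- iterates, W k = Δ^k(w), is unique.)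
Smooth : ℕ → ℕ → Word → Set
Smooth a b w =
  Σ (ℕ → Word) λ W →
    (W 0 ≡ w) ×
    (∀ k → IsDelta (W k) (W (suc k))) ×
    (∀ k → OverAB a b (W k))

-- strict lexicographic order on infinite words (letters compared as numbers,
-- which agrees with a < b)
_<lex_ : Word → Word → Set
u <lex v = ∃ λ m → (∀ i → i < m → u i ≡ v i) × (u m < v m)

InfLyndon : Word → Set
InfLyndon w = ∀ n → 1 ≤ n → w <lex (λ i → w (n + i))

-- Write v = Δ w, u = Δ² w and t = Δ³ w; every letter is at least a ≥ 2.
-- Comparing the Lyndon word w with its suffixes that start at a-runs shows that
-- no a-run is longer than the first one, hence v begins with b b, and then that
-- every a-run of length b is followed by a b-run of length b.  So a b-run of v
-- cannot end at an odd position (its last position would be even and followed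
-- by another b), and any two consecutive letters u_j, u_(j+1) with j odd sum to
-- the distance between two even positions: having equal parity, they are
-- equal.  Thus every block boundary of u is odd; but Δ t begins with a letter
-- ≥ 2, so t₀ = t₁ and the second boundary t₀ + t₁ of u is even.
module Submission where

open import Defs
open import Data.Nat using (ℕ; _<_)
open import Data.Nat.Divisibility using (_∣_)
open import Data.Product using (∃; _×_)
open import Relation.Nullary using (¬_)

open import Data.Nat using (zero; suc; _+_; _≤_; z≤n; s≤s; z<s; s<s; parity)
open import Data.Nat.Properties
  using (≤-refl; <-trans; <-irrefl; <-asym; <⇒≤; <⇒≱; <-cmp; ≤-trans; ≤-reflexive;
         m≤n+m; +-identityʳ; +-assoc; +-suc; +-comm)
open import Data.Nat.Divisibility using (divides; ∣-refl; _∣0; ∣m∣n⇒∣m+n)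
open import Data.Parity.Base as ℙ using (Parity; 0ℙ; 1ℙ; _⁻¹)
open import Data.Parity.Properties using (suc-homo-⁻¹; +-homo-+; *-homo-*; *-zeroʳ; p+p≡0ℙ)
open import Data.Product using (_,_; proj₁; proj₂)
open import Data.Sum using (_⊎_; inj₁; inj₂)
open import Data.Empty using (⊥)
open import Relation.Binary using (tri<; tri≈; tri>)
open import Relation.Binary.PropositionalEquality
  using (_≡_; _≢_; refl; sym; trans; cong; subst; subst₂; module ≡-Reasoning)
open import Relation.Nullary using (contradiction)

variable
  n : ℕ
  p q : Parity
  x y : Word

parity-suc : ∀ n → parity (suc n) ≡ parity n ⁻¹
parity-suc n = sym (suc-homo-⁻¹ (suc n))

parity-pred : ∀ n → parity (suc n) ≡ p → parity n ≡ p ⁻¹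
parity-pred n eq = trans (sym (suc-homo-⁻¹ n)) (cong _⁻¹ eq)

parity≡p⊎parity-suc≡p : ∀ n p → parity n ≡ p ⊎ parity (suc n) ≡ p
parity≡p⊎parity-suc≡p n p with parity n in eq | p
... | 0ℙ | 0ℙ = inj₁ refl
... | 1ℙ | 1ℙ = inj₁ refl
... | 0ℙ | 1ℙ = inj₂ (trans (parity-suc n) (cong _⁻¹ eq))
... | 1ℙ | 0ℙ = inj₂ (trans (parity-suc n) (cong _⁻¹ eq))

parity-summands-≡ : ∀ m x y → parity m ≡ 0ℙ → parity (m + x + y) ≡ 0ℙ → parity x ≡ parity y
parity-summands-≡ m x y m-even sum-even = p+q≡0ℙ⇒p≡q (begin
  parity x ℙ.+ parity y                ≡⟨ cong (λ π → π ℙ.+ parity x ℙ.+ parity y) m-even ⟨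
  parity m ℙ.+ parity x ℙ.+ parity y   ≡⟨ cong (ℙ._+ parity y) (+-homo-+ m x) ⟨
  parity (m + x) ℙ.+ parity y          ≡⟨ +-homo-+ (m + x) y ⟨
  parity (m + x + y)                   ≡⟨ sum-even ⟩
  0ℙ                                   ∎)
  where
  open ≡-Reasoning
  p+q≡0ℙ⇒p≡q : p ℙ.+ q ≡ 0ℙ → p ≡ q
  p+q≡0ℙ⇒p≡q {0ℙ} {0ℙ} _ = refl
  p+q≡0ℙ⇒p≡q {1ℙ} {1ℙ} _ = refl

2∣⇒parity≡0ℙ : 2 ∣ n → parity n ≡ 0ℙ
2∣⇒parity≡0ℙ (divides q refl) = trans (*-homo-* q 2) (*-zeroʳ (parity q))

¬2∣⇒parity≡1ℙ : ∀ n → ¬ 2 ∣ n → parity n ≡ 1ℙ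
¬2∣⇒parity≡1ℙ zero          2∤0    = contradiction (2 ∣0) 2∤0
¬2∣⇒parity≡1ℙ (suc zero)    _      = refl
¬2∣⇒parity≡1ℙ (suc (suc n)) 2∤2+n = ¬2∣⇒parity≡1ℙ n (λ 2∣n → 2∤2+n (∣m∣n⇒∣m+n ∣-refl 2∣n))

parity≡0ℙ⇒2≤ : 0 < n → parity n ≡ 0ℙ → 2 ≤ n
parity≡0ℙ⇒2≤ {suc (suc n)} _ _ = s≤s (s≤s z≤n)

drop : ℕ → Word → Word
drop n x i = x (n + i)

<lex-asym : x <lex y → ¬ y <lex x
<lex-asym (m , x≡y , x<y) (n , y≡x , y<x) with <-cmp m n
... | tri< m<n _ _ = <-irrefl (sym (y≡x m m<n)) x<y
... | tri≈ _ refl _ = <-asym x<y y<x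
... | tri> _ _ n<m = <-irrefl (sym (x≡y n n<m)) y<x

<lex⇒head≤ : x <lex y → x 0 ≤ y 0
<lex⇒head≤ (zero  , _     , x₀<y₀) = <⇒≤ x₀<y₀
<lex⇒head≤ (suc m , x≡y , _)     = ≤-reflexive (x≡y 0 z<s)

<lex-cons : x 0 ≡ y 0 → drop 1 x <lex drop 1 y → x <lex y
<lex-cons {x} {y} x₀≡y₀ (m , x≡y , x<y) = suc m , x≡y′ , x<y
  where
  x≡y′ : ∀ i → i < suc m → x i ≡ y i
  x≡y′ zero    _         = x₀≡y₀
  x≡y′ (suc i) (s<s i<m) = x≡y i i<m

<lex-common-prefix : ∀ n → (∀ i → i < n → x i ≡ y i) → drop n x <lex drop n y → x <lex y
<lex-common-prefix zero    _      x<y = x<y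
<lex-common-prefix (suc n) prefix x<y =
  <lex-cons (prefix 0 z<s) (<lex-common-prefix n (λ i i<n → prefix (suc i) (s<s i<n)) x<y)

InfLyndon⇒head-minimal : InfLyndon x → ∀ n → x 0 ≤ x n
InfLyndon⇒head-minimal     L zero    = ≤-refl
InfLyndon⇒head-minimal {x} L (suc n) =
  subst (λ i → x 0 ≤ x i) (+-identityʳ (suc n)) (<lex⇒head≤ (L (suc n) (s≤s z≤n)))

InfLyndon⇒suffix≮lex : InfLyndon x → 1 ≤ n → ¬ drop n x <lex x
InfLyndon⇒suffix≮lex L 1≤n = <lex-asym (L _ 1≤n)

module Blocks {w v : Word} (δ : IsDelta w v) where

  block-constant : ∀ k i → i < v k → w (startPos v k + i) ≡ w (startPos v k)
  block-constant = proj₁ (proj₂ δ)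

  boundary-≢ : ∀ k → w (startPos v (suc k)) ≢ w (startPos v k)
  boundary-≢ = proj₂ (proj₂ δ)

  startPos-suc-positive : ∀ k → 1 ≤ startPos v (suc k)
  startPos-suc-positive k = ≤-trans (proj₁ δ k) (m≤n+m (v k) (startPos v k))

  last-of-block : ∀ k → ∃ λ j → suc j ≡ startPos v (suc k) × w j ≡ w (startPos v k)
  last-of-block k with v k | proj₁ δ k | block-constant k
  ... | suc i | _ | constant = startPos v k + i , sym (+-suc (startPos v k) i) , constant i ≤-refl

  even-position-in-block : ∀ k → 2 ≤ v k → ∃ λ j → parity j ≡ 0ℙ × w j ≡ w (startPos v k)
  even-position-in-block k 2≤vₖ with parity≡p⊎parity-suc≡p (startPos v k) 0ℙ
  ... | inj₁ even = startPos v k , even , refl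
  ... | inj₂ even = suc (startPos v k) , even , trans (cong w (+-comm 1 _)) (block-constant k 1 2≤vₖ)

  block-end-parity : ∀ k p → (∀ j → parity j ≡ p → w j ≡ w (startPos v k) → w (suc j) ≡ w j) →
                     parity (startPos v (suc k)) ≡ p
  block-end-parity k p repeats with last-of-block k
  ... | j , sj≡end , wⱼ≡start with parity≡p⊎parity-suc≡p j p
  ...   | inj₂ sj-parity = subst (λ n → parity n ≡ p) sj≡end sj-parity
  ...   | inj₁ j-parity  =
    contradiction (trans (cong w (sym sj≡end)) (trans (repeats j j-parity wⱼ≡start) wⱼ≡start))
                  (boundary-≢ k)

module Letters {a b : ℕ} (a<b : a < b) where

  Letter : ℕ → Set
  Letter x = x ≡ a ⊎ x ≡ b

  a≤letter : ∀ {x} → Letter x → a ≤ x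
  a≤letter (inj₁ refl) = ≤-refl
  a≤letter (inj₂ refl) = <⇒≤ a<b

  ≢a⇒≡b : ∀ {x} → Letter x → x ≢ a → x ≡ b
  ≢a⇒≡b (inj₁ x≡a) x≢a = contradiction x≡a x≢a
  ≢a⇒≡b (inj₂ x≡b) _   = x≡b

  ≢b⇒≡a : ∀ {x} → Letter x → x ≢ b → x ≡ a
  ≢b⇒≡a (inj₁ x≡a) _   = x≡a
  ≢b⇒≡a (inj₂ x≡b) x≢b = contradiction x≡b x≢b

  parity-injective : parity a ≢ parity b → ∀ {x y} → Letter x → Letter y → parity x ≡ parity y → x ≡ y
  parity-injective _   (inj₁ refl) (inj₁ refl) _  = refl
  parity-injective _   (inj₂ refl) (inj₂ refl) _  = refl
  parity-injective a≢b (inj₁ refl) (inj₂ refl) eq = contradiction eq a≢b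
  parity-injective a≢b (inj₂ refl) (inj₁ refl) eq = contradiction (sym eq) a≢b

  ≢-≢⇒≡ : ∀ {x y z} → Letter x → Letter y → Letter z → x ≢ y → y ≢ z → x ≡ z
  ≢-≢⇒≡ x (inj₁ refl) z x≢y y≢z = trans (≢a⇒≡b x x≢y) (sym (≢a⇒≡b z (λ z≡y → y≢z (sym z≡y))))
  ≢-≢⇒≡ x (inj₂ refl) z x≢y y≢z = trans (≢b⇒≡a x x≢y) (sym (≢b⇒≡a z (λ z≡y → y≢z (sym z≡y))))

  module _ {w v : Word} (over : OverAB a b w) (δ : IsDelta w v) where
    open Blocks {w} {v} δ

    even-block-letter : ∀ k → parity k ≡ 0ℙ → w (startPos v k) ≡ w 0
    even-block-letter zero          _    = refl
    even-block-letter (suc (suc k)) even =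
      trans (≢-≢⇒≡ (over _) (over _) (over _) (boundary-≢ (suc k)) (boundary-≢ k))
            (even-block-letter k even)

    odd-block-letter : ∀ k → parity k ≡ 1ℙ → w (startPos v k) ≢ w 0
    odd-block-letter (suc k) odd same =
      boundary-≢ k (trans same (sym (even-block-letter k (parity-pred k odd))))

module LyndonRuns {a b : ℕ} (a<b : a < b) {w v : Word}
                  (over : OverAB a b w) (δ : IsDelta w v) (L : InfLyndon w) where
  open Letters a<b
  open Blocks {w} {v} δ

  head≡a : w 0 ≡ a
  head≡a with over 0
  ... | inj₁ w₀≡a = w₀≡a
  ... | inj₂ w₀≡b = contradiction (InfLyndon⇒head-minimal L (v 0)) (<⇒≱ w[v₀]<w₀)
    where
    w[v₀]<w₀ : w (v 0) < w 0
    w[v₀]<w₀ = subst₂ _<_ (sym (≢b⇒≡a (over _) (λ w[v₀]≡b → boundary-≢ 0 (trans w[v₀]≡b (sym w₀≡b)))))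
                          (sym w₀≡b) a<b

  even-block≡a : ∀ k → parity k ≡ 0ℙ → w (startPos v k) ≡ a
  even-block≡a k even = trans (even-block-letter over δ k even) head≡a

  odd-block≡b : ∀ k → parity k ≡ 1ℙ → w (startPos v k) ≡ b
  odd-block≡b k odd = ≢a⇒≡b (over _) (λ ≡a → odd-block-letter over δ k odd (trans ≡a (sym head≡a)))

  run-letter : ∀ {c} k i → i < v k → w (startPos v k) ≡ c → w (startPos v k + i) ≡ c
  run-letter k i i<vₖ start≡c = trans (block-constant k i i<vₖ) start≡c

  first-a-run-maximal : ∀ k → parity k ≡ 0ℙ → ¬ v 0 < v k
  first-a-run-maximal zero    _    v₀<v₀  = <-irrefl refl v₀<v₀
  first-a-run-maximal (suc k) even v₀<vₖ =
    InfLyndon⇒suffix≮lex L (startPos-suc-positive k) (v 0 , prefix , smaller)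
    where
    a-run : ∀ i → i < v (suc k) → w (startPos v (suc k) + i) ≡ a
    a-run i i<vₖ = run-letter (suc k) i i<vₖ (even-block≡a (suc k) even)
    prefix : ∀ i → i < v 0 → w (startPos v (suc k) + i) ≡ w i
    prefix i i<v₀ = trans (a-run i (<-trans i<v₀ v₀<vₖ)) (sym (run-letter 0 i i<v₀ head≡a))
    smaller : w (startPos v (suc k) + v 0) < w (v 0)
    smaller = subst₂ _<_ (sym (a-run (v 0) v₀<vₖ)) (sym (odd-block≡b 1 refl)) a<b

  b-run-after-equal-a-run-not-shorter : ∀ k → parity k ≡ 0ℙ → v k ≡ v 0 → ¬ v (suc k) < v 1
  b-run-after-equal-a-run-not-shorter zero    _    _     v₁<v₁   = <-irrefl refl v₁<v₁
  b-run-after-equal-a-run-not-shorter (suc k) even vₖ≡v₀ shorter =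
    InfLyndon⇒suffix≮lex L (startPos-suc-positive k)
      (<lex-common-prefix (v 0) prefix (v (suc (suc k)) , b-runs , smaller))
    where
    s : ℕ
    s = startPos v (suc k)
    prefix : ∀ i → i < v 0 → w (s + i) ≡ w i
    prefix i i<v₀ = trans (run-letter (suc k) i (subst (i <_) (sym vₖ≡v₀) i<v₀)
                                      (even-block≡a (suc k) even))
                          (sym (run-letter 0 i i<v₀ head≡a))
    shift : ∀ i → s + (v 0 + i) ≡ startPos v (suc (suc k)) + i
    shift i = trans (sym (+-assoc s (v 0) i)) (cong (λ l → s + l + i) (sym vₖ≡v₀))
    b-runs : ∀ i → i < v (suc (suc k)) → w (s + (v 0 + i)) ≡ w (v 0 + i)
    b-runs i i<vₖ₊₁ =
      trans (cong w (shift i))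
        (trans (run-letter (suc (suc k)) i i<vₖ₊₁ (odd-block≡b (suc (suc k)) (parity-pred k even)))
               (sym (run-letter 1 i (<-trans i<vₖ₊₁ shorter) (odd-block≡b 1 refl))))
    smaller : w (s + (v 0 + v (suc (suc k)))) < w (v 0 + v (suc (suc k)))
    smaller = subst₂ _<_ (sym (trans (cong w (shift _)) (even-block≡a (suc (suc (suc k))) even)))
                         (sym (run-letter 1 _ shorter (odd-block≡b 1 refl))) a<b

module SmoothLyndon {a b : ℕ} (a<b : a < b) (2≤a : 2 ≤ a)
                    (a-even : parity a ≡ 0ℙ) (b-odd : parity b ≡ 1ℙ)
                    (W : ℕ → Word) (δ : ∀ k → IsDelta (W k) (W (suc k)))
                    (over : ∀ k → OverAB a b (W k)) (L : InfLyndon (W 0)) where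
  open Letters a<b
  open LyndonRuns a<b (over 0) (δ 0) L

  v u t : Word
  v = W 1
  u = W 2
  t = W 3

  module V = Blocks {v} {u} (δ 1)
  module U = Blocks {u} {t} (δ 2)
  module T = Blocks {t} {W 4} (δ 3)

  parity-a≢parity-b : parity a ≢ parity b
  parity-a≢parity-b eq = contradiction (trans (sym a-even) (trans eq b-odd)) λ ()

  2≤letter : ∀ k i → 2 ≤ W k i
  2≤letter k i = ≤-trans 2≤a (a≤letter (over k i))

  v₀≢a : v 0 ≢ a
  v₀≢a v₀≡a with V.even-position-in-block 1 (2≤letter 2 1)
  ... | j , even , vⱼ≡second = first-a-run-maximal j even (subst₂ _<_ (sym v₀≡a) (sym vⱼ≡b) a<b)
    where
    vⱼ≡b : v j ≡ b
    vⱼ≡b = trans vⱼ≡second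
             (≢a⇒≡b (over 1 _) (λ ≡a → odd-block-letter (over 1) (δ 1) 1 refl (trans ≡a (sym v₀≡a))))

  v₀≡b : v 0 ≡ b
  v₀≡b = ≢a⇒≡b (over 1 0) v₀≢a

  v₁≡b : v 1 ≡ b
  v₁≡b = trans (V.block-constant 0 1 (2≤letter 2 0)) v₀≡b

  a-run-of-length-b-followed-by-b : ∀ k → parity k ≡ 0ℙ → v k ≡ b → v (suc k) ≡ b
  a-run-of-length-b-followed-by-b k even vₖ≡b = ≢a⇒≡b (over 1 _) λ vₖ₊₁≡a →
    b-run-after-equal-a-run-not-shorter k even (trans vₖ≡b (sym v₀≡b))
                                        (subst₂ _<_ (sym vₖ₊₁≡a) (sym v₁≡b) a<b)

  b-block-of-v-ends-even : ∀ r → v (startPos u r) ≡ b → parity (startPos u (suc r)) ≡ 0ℙ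
  b-block-of-v-ends-even r b-block = V.block-end-parity r 0ℙ repeats
    where
    repeats : ∀ j → parity j ≡ 0ℙ → v j ≡ v (startPos u r) → v (suc j) ≡ v j
    repeats j even vⱼ≡start = trans (a-run-of-length-b-followed-by-b j even vⱼ≡b) (sym vⱼ≡b)
      where
      vⱼ≡b : v j ≡ b
      vⱼ≡b = trans vⱼ≡start b-block

  u-odd-position-repeats : ∀ j → parity j ≡ 1ℙ → u j ≡ u (suc j)
  u-odd-position-repeats (suc r) odd =
    parity-injective parity-a≢parity-b (over 2 _) (over 2 _)
      (parity-summands-≡ (startPos u (suc r)) _ _ (ends-even r r-even) (ends-even (suc (suc r)) r-even))
    where
    r-even : parity r ≡ 0ℙ
    r-even = parity-pred r odd
    ends-even : ∀ k → parity k ≡ 0ℙ → parity (startPos u (suc k)) ≡ 0ℙ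
    ends-even k even = b-block-of-v-ends-even k (trans (even-block-letter (over 1) (δ 1) k even) v₀≡b)

  u-block-ends-odd : ∀ k → parity (startPos t (suc k)) ≡ 1ℙ
  u-block-ends-odd k = U.block-end-parity k 1ℙ (λ j odd _ → sym (u-odd-position-repeats j odd))

  impossible : ⊥
  impossible = contradiction (trans (sym t₀+t₁-even) (u-block-ends-odd 1)) λ ()
    where
    t₁≡t₀ : t 1 ≡ t 0
    t₁≡t₀ = T.block-constant 0 1 (2≤letter 4 0)
    t₀+t₁-even : parity (t 0 + t 1) ≡ 0ℙ
    t₀+t₁-even = trans (cong (λ n → parity (t 0 + n)) t₁≡t₀)
                       (trans (+-homo-+ (t 0) (t 0)) (p+p≡0ℙ (parity (t 0))))

theorem15 : (a b : ℕ) → 0 < a → a < b → 2 ∣ a → ¬ (2 ∣ b) →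
    ¬ (∃ λ w → Smooth a b w × InfLyndon w)
theorem15 a b 0<a a<b 2∣a 2∤b (w , (W , W₀≡w , δ , over) , L) =
  SmoothLyndon.impossible a<b (parity≡0ℙ⇒2≤ 0<a a-even) a-even (¬2∣⇒parity≡1ℙ b 2∤b)
                          W δ over (subst InfLyndon (sym W₀≡w) L)
  where
  a-even : parity a ≡ 0ℙ
  a-even = 2∣⇒parity≡0ℙ 2∣a
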